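{- Let $\mathbb F_q$ be any finite field. Then $R_q(2,t)\le m_q(t)$ for all $t\ge 2$.
   Context: $R_q(2,t)$ is the minimum $n$ such that in every red-blue coloring of the $1$-dimensional linear subspaces of $\mathbb F_q^n$ there is either a linear $2$-dimensional subspace all of whose $1$-dimensional subspaces are red, or a linear $t$-dimensional subspace all of whose $1$-dimensional subspaces are blue. For $A\subseteq\mathbb F_q^n$, the direction set is $A^\to=\{d\in\mathbb F_q^n:\exists x \text{ with } x+\lambda d\in A\ \forall\lambda\in\mathbb F_q\}$, and $\omega^\to(A)$ is the largest dimension of a linear subspace of $\mathbb F_q^n$ contained in $A^\to\cup\{0\}$. $m_q(t)$ is the minimum $n$ such that every $A\subseteq\mathbb F_q^n$ with $|A|\ge q^{n-t+1}$ satisfies $\omega^\to(A)\ge t$ (this minimum exists by the Furstenberg–Katznelson theorem). -}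

module Defs where

open import Data.Nat using (ℕ; zero; suc; _+_; _*_; _^_; _≤_; _<_)
open import Data.Fin using (Fin)
open import Data.Bool using (Bool; true; false; if_then_else_)
open import Data.List using (List; []; _∷_; [_]; concatMap; map; allFin)
open import Data.Vec using (Vec; []; _∷_; replicate; zipWith)
import Data.Vec as Vec
open import Data.Product using (Σ; ∃; _×_)
open import Relation.Nullary using (¬_)
open import Relation.Binary.PropositionalEquality using (_≡_)
open import Algebra.Structures using (IsCommutativeRing)

-- A finite field with q elements, with carrier Fin q (every finite field of
-- order q is isomorphic to one of this form).
record FiniteField (q : ℕ) : Set where
  field
    _+F_ : Fin q → Fin q → Fin q
    _*F_ : Fin q → Fin q → Fin q
    -F_  : Fin q → Fin q
    0F   : Fin q
    1F   : Fin q
    isCommutativeRing : IsCommutativeRing _≡_ _+F_ _*F_ -F_ 0F 1F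
    0≢1  : ¬ (0F ≡ 1F)
    inverse : ∀ x → ¬ (x ≡ 0F) → ∃ λ y → x *F y ≡ 1F

module _ {q : ℕ} (F : FiniteField q) where
  open FiniteField F

  Vecq : ℕ → Set
  Vecq n = Vec (Fin q) n

  zeroV : ∀ {n} → Vecq n
  zeroV = replicate _ 0F

  _+V_ : ∀ {n} → Vecq n → Vecq n → Vecq n
  _+V_ = zipWith _+F_

  _·V_ : ∀ {n} → Fin q → Vecq n → Vecq n
  λ₀ ·V v = Vec.map (λ₀ *F_) v

  linComb : ∀ {n k} → Vec (Fin q) k → Vec (Vecq n) k → Vecq n
  linComb [] [] = zeroV
  linComb (c ∷ cs) (v ∷ vs) = (c ·V v) +V linComb cs vs

  LinIndep : ∀ {n k} → Vec (Vecq n) k → Set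
  LinIndep {n} {k} vs = ∀ (c : Vec (Fin q) k) → linComb c vs ≡ zeroV → c ≡ zeroV

  allVecs : ∀ n → List (Vecq n)
  allVecs zero = [ [] ]
  allVecs (suc n) = concatMap (λ x → map (x ∷_) (allVecs n)) (allFin q)

  countTrue : ∀ {n} → (Vecq n → Bool) → List (Vecq n) → ℕ
  countTrue A [] = 0
  countTrue A (x ∷ xs) = (if A x then 1 else 0) + countTrue A xs

  card : ∀ {n} → (Vecq n → Bool) → ℕ
  card {n} A = countTrue A (allVecs n)

  InDirSet : ∀ {n} → (Vecq n → Bool) → Vecq n → Set
  InDirSet A d = Σ _ λ x → ∀ (λ₀ : Fin q) → A (x +V (λ₀ ·V d)) ≡ true

  SubspaceWithin : ∀ {n} → ℕ → (Vecq n → Set) → Set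
  SubspaceWithin {n} k P = Σ (Vec (Vecq n) k) λ vs → LinIndep vs ×
    (∀ (c : Vec (Fin q) k) → ¬ (c ≡ zeroV) → P (linComb c vs))

  ωDir≥ : ∀ {n} → (Vecq n → Bool) → ℕ → Set
  ωDir≥ A t = Σ ℕ λ k → t ≤ k × SubspaceWithin k (InDirSet A)

  -- the defining property of m_q(t) at n:  |A| ≥ q^(n-t+1)  ⇒  ω^→(A) ≥ t
  -- (|A| ≥ q^(n+1-t) is written as q^(n+1) ≤ |A| * q^t, exact over ℤ exponents)
  MProp : ℕ → ℕ → Set
  MProp t n = ∀ (A : Vecq n → Bool) → q ^ (n + 1) ≤ card A * q ^ t → ωDir≥ A t

  -- colourings of 1-dim subspaces: functions constant on each line minus 0
  -- (true = red, false = blue; the value at 0 is irrelevant)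
  LineColouring : ℕ → Set
  LineColouring n = Σ (Vecq n → Bool) λ χ →
    ∀ (v : Vecq n) (λ₀ : Fin q) → ¬ (v ≡ zeroV) → ¬ (λ₀ ≡ 0F) → χ (λ₀ ·V v) ≡ χ v

  RamseyProp : ℕ → ℕ → Set
  RamseyProp t n = ∀ (χ : LineColouring n) →
    Data.Sum._⊎_ (SubspaceWithin 2 (λ v → Data.Product.proj₁ χ v ≡ true))
                 (SubspaceWithin t (λ v → Data.Product.proj₁ χ v ≡ false))
    where import Data.Sum; import Data.Product

  IsMq : ℕ → ℕ → Set
  IsMq t n = MProp t n × (∀ m → m < n → ¬ MProp t m)

module Submission where

-- Let n = m_q(t), colour the lines of F_q^n and let R be the set of nonzero red
-- vectors, a cone (closed under nonzero scalars).  Necessarily n > t: otherwise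
-- F_q^0 or a coordinate axis is large enough for the defining property of m_q(t)
-- but has no plane in its direction set.  Write n = t + s + 1.
--
-- If |R| ≥ q^(s+2) = q^(n-t+1), some t-dimensional W lies in R^→.  Either every
-- nonzero vector of W is blue, or a red d ∈ W has a whole line x + F_q d inside R,
-- and then span(d, x) is a red plane.
--
-- If |R| ≤ q^(s+2) - 2, a blue t-space is built greedily: pick a blue b ≠ 0 and
-- pass to F_q^n / ⟨b⟩, where the image of R is again a cone with at most |R|
-- points; blue subspaces there lift back together with b.  In the remaining case
-- |R| = q^(s+2) - 1, take red p, p′ with p′ ∉ ⟨p⟩.  Either span(p, p′) is red, or
-- quotienting by a blue w in it identifies p′ with a red multiple of p, which
-- brings the image of R below the greedy bound.

open import Defs
open import Algebra.Bundles using (CommutativeRing)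
open import Algebra.Structures using (IsCommutativeRing)
import Algebra.Properties.CommutativeSemigroup as CommutativeSemigroupProperties
import Algebra.Properties.Ring as RingProperties
open import Data.Bool using (Bool; true; false; if_then_else_; _∧_; _∨_; not)
open import Data.Bool.ListAction using (any)
open import Data.Bool.Properties
  using (∧-identityˡ; ∧-identityʳ; ∧-conicalˡ; ∧-conicalʳ; ∧-zeroʳ; ∧-inverseʳ; ∨-zeroʳ;
         ¬-not; not-¬; not-injective)
open import Data.Empty using (⊥-elim)
open import Data.Fin as Fin using (Fin)
open import Data.Fin.Properties using (nonZeroIndex)
open import Data.List as List using (List; []; _∷_; map; length; allFin; cartesianProductWith; concatMap)
open import Data.List.Properties using (length-++; length-map; length-tabulate)
open import Data.List.Membership.Propositional using (_∈_)
open import Data.List.Membership.Propositional.Properties using (∈-cartesianProductWith⁺; ∈-allFin)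
open import Data.List.Relation.Unary.All as All using (All; []; _∷_)
open import Data.List.Relation.Unary.AllPairs using ([]; _∷_)
open import Data.List.Relation.Unary.Any using (here; there)
open import Data.List.Relation.Unary.Unique.Propositional using (Unique)
open import Data.List.Relation.Unary.Unique.Propositional.Properties using (cartesianProductWith⁺; allFin⁺)
open import Data.Nat using (ℕ; zero; suc; _+_; _*_; _^_; _≤_; _<_; _≤?_; _<?_; NonZero; z≤n; s≤s)
import Data.Nat.Properties as ℕ
open import Data.Nat.Properties
  using (≤-reflexive; ≤-trans; <-trans; ≤-<-trans; ≤-pred; <-irrefl; n≤1+n; n<1+n; m≤n+m; m≤m+n; m≤n⇒m≤1+n;
         +-suc; +-mono-≤; +-monoˡ-≤; +-monoʳ-≤; *-monoˡ-≤; *-monoʳ-≤; ^-monoʳ-≤; ^-distribˡ-+-*;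
         ≰⇒>; ≮⇒≥; <⇒≤; m≤n⇒∃[o]m+o≡n; m≤n⇒m<n∨m≡n; module ≤-Reasoning)
open import Data.Product using (∃; _×_; _,_; proj₁; proj₂)
open import Data.Sum as Sum using (_⊎_; inj₁; inj₂)
open import Data.Vec as Vec using (Vec; []; _∷_; _++_; replicate; splitAt; tail)
open import Data.Vec.Properties
  using (≡-dec; ∷-injective; ∷-injectiveˡ; ∷-injectiveʳ; map-cong; map-∘; map-id; map-const; map-replicate)
open import Data.Vec.Relation.Binary.Pointwise.Inductive
  using (Pointwise-≡⇒≡; zipWith-assoc; zipWith-comm; zipWith-identityˡ; zipWith-identityʳ)
open import Function using (_∘_; id)
open import Relation.Binary.Definitions using (DecidableEquality)
open import Relation.Binary.PropositionalEquality
  using (_≡_; _≢_; refl; sym; trans; cong; cong₂; subst; module ≡-Reasoning)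
open import Relation.Nullary using (¬_)
open import Relation.Nullary.Decidable using (Dec; yes; no; ⌊_⌋)

module _ {X : Set} where

  count : (X → Bool) → List X → ℕ
  count P []       = 0
  count P (x ∷ xs) = (if P x then 1 else 0) + count P xs

  count-++ : ∀ P xs ys → count P (xs List.++ ys) ≡ count P xs + count P ys
  count-++ P []       ys = refl
  count-++ P (x ∷ xs) ys = trans (cong (_ +_) (count-++ P xs ys)) (sym (ℕ.+-assoc (if P x then 1 else 0) _ _))

  count-cong-All : ∀ {P Q : X → Bool} {xs} → All (λ x → P x ≡ Q x) xs → count P xs ≡ count Q xs
  count-cong-All {xs = []}     []           = refl
  count-cong-All {xs = x ∷ xs} (Px≡Qx ∷ eq) rewrite Px≡Qx = cong (_ +_) (count-cong-All eq)

  count-cong : ∀ {P Q : X → Bool} → (∀ x → P x ≡ Q x) → ∀ xs → count P xs ≡ count Q xs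
  count-cong P≗Q xs = count-cong-All {xs = xs} (All.tabulate λ {x} _ → P≗Q x)

  count-false : ∀ xs → count (λ _ → false) xs ≡ 0
  count-false []       = refl
  count-false (x ∷ xs) = count-false xs

  count-true : ∀ xs → count (λ _ → true) xs ≡ length xs
  count-true []       = refl
  count-true (x ∷ xs) = cong suc (count-true xs)

  count-≤-length : ∀ P xs → count P xs ≤ length xs
  count-≤-length P []       = z≤n
  count-≤-length P (x ∷ xs) with P x
  ... | true  = s≤s (count-≤-length P xs)
  ... | false = m≤n⇒m≤1+n (count-≤-length P xs)

  count-mono : ∀ {P Q} → (∀ x → P x ≡ true → Q x ≡ true) → ∀ xs → count P xs ≤ count Q xs
  count-mono         P⊆Q []       = z≤n
  count-mono {P} {Q} P⊆Q (x ∷ xs) with P x in Px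
  ... | true  rewrite P⊆Q x Px = s≤s (count-mono P⊆Q xs)
  ... | false = ≤-trans (count-mono P⊆Q xs) (m≤n+m _ (if Q x then 1 else 0))

  count-∨ : ∀ P Q xs → count (λ x → P x ∨ Q x) xs ≤ count P xs + count Q xs
  count-∨ P Q []       = z≤n
  count-∨ P Q (x ∷ xs) with P x | Q x
  ... | true  | true  = s≤s (≤-trans (count-∨ P Q xs) (+-monoʳ-≤ (count P xs) (n≤1+n _)))
  ... | true  | false = s≤s (count-∨ P Q xs)
  ... | false | true  = ≤-trans (s≤s (count-∨ P Q xs)) (≤-reflexive (sym (+-suc _ _)))
  ... | false | false = count-∨ P Q xs

  count-pos : ∀ P xs → 0 < count P xs → ∃ λ x → P x ≡ true
  count-pos P (x ∷ xs) pos with P x in Px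
  ... | true  = x , Px
  ... | false = count-pos P xs pos

  count-witness : ∀ P Q xs → count P xs < count Q xs → ∃ λ x → Q x ≡ true × P x ≡ false
  count-witness P Q (x ∷ xs) P<Q with P x in Px | Q x in Qx
  ... | false | true  = x , Qx , Px
  ... | true  | true  = count-witness P Q xs (≤-pred P<Q)
  ... | true  | false = count-witness P Q xs (<-trans (n<1+n _) P<Q)
  ... | false | false = count-witness P Q xs P<Q

  search : ∀ (P : X → Bool) xs → (∃ λ x → P x ≡ true) ⊎ (∀ x → x ∈ xs → P x ≡ false)
  search P []       = inj₂ λ _ ()
  search P (y ∷ xs) with P y in Py
  ... | true  = inj₁ (y , Py)
  ... | false with search P xs
  ...   | inj₁ found  = inj₁ found
  ...   | inj₂ absent = inj₂ λ { x (here refl) → Py ; x (there x∈xs) → absent x x∈xs }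

module _ {X Y : Set} where

  count-map : ∀ (P : X → Bool) (f : Y → X) ys → count P (map f ys) ≡ count (P ∘ f) ys
  count-map P f []       = refl
  count-map P f (y ∷ ys) = cong (_ +_) (count-map P f ys)

module _ {X : Set} (_≟_ : DecidableEquality X) where

  count-≟-≤1 : ∀ y {xs} → Unique xs → count (λ x → ⌊ y ≟ x ⌋) xs ≤ 1
  count-≟-≤1 y {[]}     []           = z≤n
  count-≟-≤1 y {x ∷ xs} (x∉xs ∷ uniq) with y ≟ x
  ... | no  _    = count-≟-≤1 y uniq
  ... | yes refl = s≤s (≤-reflexive (absent xs x∉xs))
    where
    absent : ∀ zs → All (y ≢_) zs → count (λ z → ⌊ y ≟ z ⌋) zs ≡ 0
    absent []       []            = refl
    absent (z ∷ zs) (y≢z ∷ y∉zs) with y ≟ z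
    ... | yes y≡z = ⊥-elim (y≢z y≡z)
    ... | no  _   = absent zs y∉zs

  count-remove : ∀ P {y xs} → Unique xs → y ∈ xs → P y ≡ true →
                 count P xs ≡ suc (count (λ x → P x ∧ not ⌊ x ≟ y ⌋) xs)
  count-remove P {y} (y∉xs ∷ _) (here refl) Py with y ≟ y
  ... | no  y≢y = ⊥-elim (y≢y refl)
  ... | yes _   rewrite Py = cong suc (count-cong-All (All.map keep y∉xs))
    where
    keep : ∀ {x} → y ≢ x → P x ≡ (P x ∧ not ⌊ x ≟ y ⌋)
    keep {x} y≢x with x ≟ y
    ... | yes x≡y = ⊥-elim (y≢x (sym x≡y))
    ... | no  _   = sym (∧-identityʳ (P x))
  count-remove P {y} {x ∷ xs} (x∉xs ∷ uniq) (there y∈xs) Py with x ≟ y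
  ... | yes refl = ⊥-elim (All.lookup x∉xs y∈xs refl)
  ... | no  _    rewrite ∧-identityʳ (P x) = trans (cong (_ +_) (count-remove P uniq y∈xs Py))
                         (+-suc (if P x then 1 else 0) _)

module _ {X Y : Set} (_≟_ : DecidableEquality Y) (f : X → Y) where

  image : (X → Bool) → List X → Y → Bool
  image P xs y = any (λ x → P x ∧ ⌊ f x ≟ y ⌋) xs

  image-intro : ∀ P {x xs} → x ∈ xs → P x ≡ true → image P xs (f x) ≡ true
  image-intro P {x} (here refl) Px rewrite Px with f x ≟ f x
  ... | yes _    = refl
  ... | no fx≢fx = ⊥-elim (fx≢fx refl)
  image-intro P {xs = _ ∷ xs} (there x∈xs) Px rewrite image-intro P x∈xs Px = ∨-zeroʳ _

  image-elim : ∀ P xs {y} → image P xs y ≡ true → ∃ λ x → P x ≡ true × f x ≡ y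
  image-elim P (x ∷ xs) {y} img with P x in Px | f x ≟ y
  ... | true  | yes fx≡y = x , Px , fx≡y
  ... | true  | no  _    = image-elim P xs img
  ... | false | _        = image-elim P xs img

  count-image : ∀ P xs {ys} → Unique ys → count (image P xs) ys ≤ count P xs
  count-image P []       {ys} _    = ≤-reflexive (count-false ys)
  count-image P (x ∷ xs) {ys} uniq with P x
  ... | false = count-image P xs uniq
  ... | true  = ≤-trans (count-∨ _ _ ys) (+-mono-≤ (count-≟-≤1 _≟_ (f x) uniq) (count-image P xs uniq))

module VectorSpace {q : ℕ} (F : FiniteField q) where

  open FiniteField F
  open IsCommutativeRing isCommutativeRing
    using (+-comm; +-assoc; +-identityˡ; +-identityʳ; -‿inverseʳ; *-assoc; *-identityˡ; *-identityʳ;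
           distribˡ; distribʳ; zeroˡ; zeroʳ)
    renaming (*-comm to *F-comm)
  open ≡-Reasoning

  commutativeRing : CommutativeRing _ _
  commutativeRing = record { isCommutativeRing = isCommutativeRing }

  open RingProperties (CommutativeRing.ring commutativeRing) using (-‿involutive; -0#≈0#; -‿distribʳ-*)
  open CommutativeSemigroupProperties (CommutativeRing.+-commutativeSemigroup commutativeRing) using (interchange)

  _≟F_ : DecidableEquality (Fin q)
  _≟F_ = Fin._≟_

  inv : ∀ a → a ≢ 0F → Fin q
  inv a a≢0 = proj₁ (inverse a a≢0)

  inv-inverseʳ : ∀ a (a≢0 : a ≢ 0F) → a *F inv a a≢0 ≡ 1F
  inv-inverseʳ a a≢0 = proj₂ (inverse a a≢0)

  inv-inverseˡ : ∀ a (a≢0 : a ≢ 0F) → inv a a≢0 *F a ≡ 1F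
  inv-inverseˡ a a≢0 = trans (*F-comm _ a) (inv-inverseʳ a a≢0)

  inv-cancelˡ : ∀ a (a≢0 : a ≢ 0F) b → inv a a≢0 *F (a *F b) ≡ b
  inv-cancelˡ a a≢0 b = begin
    inv a a≢0 *F (a *F b)  ≡⟨ *-assoc _ a b ⟨
    (inv a a≢0 *F a) *F b  ≡⟨ cong (_*F b) (inv-inverseˡ a a≢0) ⟩
    1F *F b                ≡⟨ *-identityˡ b ⟩
    b                      ∎

  inv-cancelʳ : ∀ a (a≢0 : a ≢ 0F) b → a *F (inv a a≢0 *F b) ≡ b
  inv-cancelʳ a a≢0 b = begin
    a *F (inv a a≢0 *F b)  ≡⟨ *-assoc a _ b ⟨
    (a *F inv a a≢0) *F b  ≡⟨ cong (_*F b) (inv-inverseʳ a a≢0) ⟩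
    1F *F b                ≡⟨ *-identityˡ b ⟩
    b                      ∎

  x*b⁻¹*b≡x : ∀ x {b} (b≢0 : b ≢ 0F) → (x *F inv b b≢0) *F b ≡ x
  x*b⁻¹*b≡x x {b} b≢0 = begin
    (x *F inv b b≢0) *F b  ≡⟨ *-assoc x _ b ⟩
    x *F (inv b b≢0 *F b)  ≡⟨ cong (x *F_) (inv-inverseˡ b b≢0) ⟩
    x *F 1F                ≡⟨ *-identityʳ x ⟩
    x                      ∎

  inv-≢0 : ∀ a (a≢0 : a ≢ 0F) → inv a a≢0 ≢ 0F
  inv-≢0 a a≢0 inv≡0 = 0≢1 (begin
    0F               ≡⟨ zeroʳ a ⟨
    a *F 0F          ≡⟨ cong (a *F_) inv≡0 ⟨
    a *F inv a a≢0   ≡⟨ inv-inverseʳ a a≢0 ⟩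
    1F               ∎)

  *-≢0 : ∀ {a b} → a ≢ 0F → b ≢ 0F → a *F b ≢ 0F
  *-≢0 {a} {b} a≢0 b≢0 ab≡0 = b≢0 (begin
    b                      ≡⟨ inv-cancelˡ a a≢0 b ⟨
    inv a a≢0 *F (a *F b)  ≡⟨ cong (inv a a≢0 *F_) ab≡0 ⟩
    inv a a≢0 *F 0F        ≡⟨ zeroʳ _ ⟩
    0F                     ∎)

  -‿≢0 : ∀ {a} → a ≢ 0F → -F a ≢ 0F
  -‿≢0 {a} a≢0 -a≡0 = a≢0 (begin
    a           ≡⟨ -‿involutive a ⟨
    -F (-F a)   ≡⟨ cong -F_ -a≡0 ⟩
    -F 0F       ≡⟨ -0#≈0# ⟩
    0F          ∎)

  V : ℕ → Set
  V = Vecq F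

  infixl 6 _⊕_
  infixr 7 _⊙_

  0V : ∀ {n} → V n
  0V = zeroV F

  _⊕_ : ∀ {n} → V n → V n → V n
  _⊕_ = _+V_ F

  _⊙_ : ∀ {n} → Fin q → V n → V n
  _⊙_ = _·V_ F

  lc : ∀ {n k} → Vec (Fin q) k → Vec (V n) k → V n
  lc = linComb F

  _≟V_ : ∀ {n} → DecidableEquality (V n)
  _≟V_ = ≡-dec _≟F_

  nonzero : ∀ {n} → V n → Bool
  nonzero v = not ⌊ v ≟V 0V ⌋

  nonzero-≢0 : ∀ {n} {v : V n} → nonzero v ≡ true → v ≢ 0V
  nonzero-≢0 {v = v} nz with v ≟V 0V
  nonzero-≢0 () | yes _
  nonzero-≢0 _  | no v≢0 = v≢0

  ≢0-nonzero : ∀ {n} {v : V n} → v ≢ 0V → nonzero v ≡ true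
  ≢0-nonzero {v = v} v≢0 with v ≟V 0V
  ... | yes v≡0 = ⊥-elim (v≢0 v≡0)
  ... | no  _   = refl

  ≟V-≡true : ∀ {n} {u v : V n} → ⌊ u ≟V v ⌋ ≡ true → u ≡ v
  ≟V-≡true {u = u} {v} eq with u ≟V v
  ≟V-≡true _  | yes u≡v = u≡v
  ≟V-≡true () | no _

  ≟V-refl : ∀ {n} (v : V n) → ⌊ v ≟V v ⌋ ≡ true
  ≟V-refl v with v ≟V v
  ... | yes _   = refl
  ... | no  v≢v = ⊥-elim (v≢v refl)

  nonzero-0V : ∀ {n} → nonzero (0V {n}) ≡ false
  nonzero-0V = cong not (≟V-refl 0V)

  ⊕-assoc : ∀ {n} (u v w : V n) → (u ⊕ v) ⊕ w ≡ u ⊕ (v ⊕ w)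
  ⊕-assoc u v w = Pointwise-≡⇒≡ (zipWith-assoc +-assoc u v w)

  ⊕-comm : ∀ {n} (u v : V n) → u ⊕ v ≡ v ⊕ u
  ⊕-comm u v = Pointwise-≡⇒≡ (zipWith-comm +-comm u v)

  ⊕-identityˡ : ∀ {n} (v : V n) → 0V ⊕ v ≡ v
  ⊕-identityˡ v = Pointwise-≡⇒≡ (zipWith-identityˡ +-identityˡ v)

  ⊕-identityʳ : ∀ {n} (v : V n) → v ⊕ 0V ≡ v
  ⊕-identityʳ v = Pointwise-≡⇒≡ (zipWith-identityʳ +-identityʳ v)

  ⊕-interchange : ∀ {n} (u v w z : V n) → (u ⊕ v) ⊕ (w ⊕ z) ≡ (u ⊕ w) ⊕ (v ⊕ z)
  ⊕-interchange []      []      []      []      = refl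
  ⊕-interchange (a ∷ u) (b ∷ v) (c ∷ w) (d ∷ z) = cong₂ _∷_ (interchange a b c d) (⊕-interchange u v w z)

  ⊙-distribˡ : ∀ {n} a (u v : V n) → a ⊙ (u ⊕ v) ≡ a ⊙ u ⊕ a ⊙ v
  ⊙-distribˡ a []      []      = refl
  ⊙-distribˡ a (x ∷ u) (y ∷ v) = cong₂ _∷_ (distribˡ a x y) (⊙-distribˡ a u v)

  ⊙-distribʳ : ∀ {n} a b (v : V n) → (a +F b) ⊙ v ≡ a ⊙ v ⊕ b ⊙ v
  ⊙-distribʳ a b []      = refl
  ⊙-distribʳ a b (x ∷ v) = cong₂ _∷_ (distribʳ x a b) (⊙-distribʳ a b v)

  ⊙-assoc : ∀ {n} a b (v : V n) → (a *F b) ⊙ v ≡ a ⊙ (b ⊙ v)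
  ⊙-assoc a b v = trans (map-cong (*-assoc a b) v) (map-∘ (a *F_) (b *F_) v)

  ⊙-identityˡ : ∀ {n} (v : V n) → 1F ⊙ v ≡ v
  ⊙-identityˡ v = trans (map-cong *-identityˡ v) (map-id v)

  ⊙-zeroˡ : ∀ {n} (v : V n) → 0F ⊙ v ≡ 0V
  ⊙-zeroˡ v = trans (map-cong zeroˡ v) (map-const v 0F)

  ⊙-zeroʳ : ∀ {n} a → a ⊙ 0V {n} ≡ 0V
  ⊙-zeroʳ {n} a = trans (map-replicate (a *F_) 0F n) (cong (replicate n) (zeroʳ a))

  ⊙-inverse : ∀ {n} a (v : V n) → a ⊙ v ⊕ (-F a) ⊙ v ≡ 0V
  ⊙-inverse a v = begin
    a ⊙ v ⊕ (-F a) ⊙ v  ≡⟨ ⊙-distribʳ a (-F a) v ⟨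
    (a +F (-F a)) ⊙ v    ≡⟨ cong (_⊙ v) (-‿inverseʳ a) ⟩
    0F ⊙ v              ≡⟨ ⊙-zeroˡ v ⟩
    0V                  ∎

  u⊕a⊙w≡0⇒u≡-a⊙w : ∀ {n} (u w : V n) a → u ⊕ a ⊙ w ≡ 0V → u ≡ (-F a) ⊙ w
  u⊕a⊙w≡0⇒u≡-a⊙w u w a eq = begin
    u                            ≡⟨ ⊕-identityʳ u ⟨
    u ⊕ 0V                       ≡⟨ cong (u ⊕_) (⊙-inverse a w) ⟨
    u ⊕ (a ⊙ w ⊕ (-F a) ⊙ w)     ≡⟨ ⊕-assoc u _ _ ⟨
    (u ⊕ a ⊙ w) ⊕ (-F a) ⊙ w     ≡⟨ cong (_⊕ (-F a) ⊙ w) eq ⟩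
    0V ⊕ (-F a) ⊙ w              ≡⟨ ⊕-identityˡ _ ⟩
    (-F a) ⊙ w                   ∎

  ⊙-inv-cancel : ∀ {n} a (a≢0 : a ≢ 0F) (v : V n) → inv a a≢0 ⊙ (a ⊙ v) ≡ v
  ⊙-inv-cancel a a≢0 v = begin
    inv a a≢0 ⊙ (a ⊙ v)   ≡⟨ ⊙-assoc _ a v ⟨
    (inv a a≢0 *F a) ⊙ v  ≡⟨ cong (_⊙ v) (inv-inverseˡ a a≢0) ⟩
    1F ⊙ v                ≡⟨ ⊙-identityˡ v ⟩
    v                     ∎

  a⊙v≡0⇒v≡0 : ∀ {n} {a} {v : V n} → a ≢ 0F → a ⊙ v ≡ 0V → v ≡ 0V
  a⊙v≡0⇒v≡0 {a = a} {v} a≢0 av≡0 = begin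
    v                    ≡⟨ ⊙-inv-cancel a a≢0 v ⟨
    inv a a≢0 ⊙ (a ⊙ v)  ≡⟨ cong (inv a a≢0 ⊙_) av≡0 ⟩
    inv a a≢0 ⊙ 0V       ≡⟨ ⊙-zeroʳ _ ⟩
    0V                   ∎

  a⊙v≡0⇒a≡0 : ∀ {n} {a} {v : V n} → v ≢ 0V → a ⊙ v ≡ 0V → a ≡ 0F
  a⊙v≡0⇒a≡0 {a = a} v≢0 av≡0 with a ≟F 0F
  ... | yes a≡0 = a≡0
  ... | no  a≢0 = ⊥-elim (v≢0 (a⊙v≡0⇒v≡0 a≢0 av≡0))

  ⊙-≢0 : ∀ {n} {a} {v : V n} → a ≢ 0F → v ≢ 0V → a ⊙ v ≢ 0V
  ⊙-≢0 a≢0 v≢0 av≡0 = v≢0 (a⊙v≡0⇒v≡0 a≢0 av≡0)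

  lc-zeroˡ : ∀ {n k} (vs : Vec (V n) k) → lc 0V vs ≡ 0V
  lc-zeroˡ []       = refl
  lc-zeroˡ (v ∷ vs) = trans (cong₂ _⊕_ (⊙-zeroˡ v) (lc-zeroˡ vs)) (⊕-identityˡ _)

  lc₂ : ∀ {n} c₁ c₂ (u v : V n) → lc (c₁ ∷ c₂ ∷ []) (u ∷ v ∷ []) ≡ c₁ ⊙ u ⊕ c₂ ⊙ v
  lc₂ c₁ c₂ u v = cong (c₁ ⊙ u ⊕_) (⊕-identityʳ (c₂ ⊙ v))

  lc₂-zeroˡ : ∀ {n} c₂ (u v : V n) → lc (0F ∷ c₂ ∷ []) (u ∷ v ∷ []) ≡ c₂ ⊙ v
  lc₂-zeroˡ c₂ u v = trans (lc₂ 0F c₂ u v) (trans (cong (_⊕ c₂ ⊙ v) (⊙-zeroˡ u)) (⊕-identityˡ _))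

  lc₂-zeroʳ : ∀ {n} c₁ (u v : V n) → lc (c₁ ∷ 0F ∷ []) (u ∷ v ∷ []) ≡ c₁ ⊙ u
  lc₂-zeroʳ c₁ u v = trans (lc₂ c₁ 0F u v) (trans (cong (c₁ ⊙ u ⊕_) (⊙-zeroˡ v)) (⊕-identityʳ _))

  lc₂-factor : ∀ {n} c₁ {c₂} (c₂≢0 : c₂ ≢ 0F) (u v : V n) →
               lc (c₁ ∷ c₂ ∷ []) (u ∷ v ∷ []) ≡ c₂ ⊙ (v ⊕ (inv c₂ c₂≢0 *F c₁) ⊙ u)
  lc₂-factor c₁ {c₂} c₂≢0 u v = begin
    lc (c₁ ∷ c₂ ∷ []) (u ∷ v ∷ [])             ≡⟨ lc₂ c₁ c₂ u v ⟩
    c₁ ⊙ u ⊕ c₂ ⊙ v                            ≡⟨ ⊕-comm _ _ ⟩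
    c₂ ⊙ v ⊕ c₁ ⊙ u                            ≡⟨ cong (λ c → c₂ ⊙ v ⊕ c ⊙ u) (inv-cancelʳ c₂ c₂≢0 c₁) ⟨
    c₂ ⊙ v ⊕ (c₂ *F (inv c₂ c₂≢0 *F c₁)) ⊙ u  ≡⟨ cong (c₂ ⊙ v ⊕_) (⊙-assoc c₂ _ u) ⟩
    c₂ ⊙ v ⊕ c₂ ⊙ ((inv c₂ c₂≢0 *F c₁) ⊙ u)   ≡⟨ ⊙-distribˡ c₂ v _ ⟨
    c₂ ⊙ (v ⊕ (inv c₂ c₂≢0 *F c₁) ⊙ u)        ∎

  lc-≢0 : ∀ {n k} {vs : Vec (V n) k} → LinIndep F vs → ∀ {c} → c ≢ 0V → lc c vs ≢ 0V
  lc-≢0 indep c≢0 lc≡0 = c≢0 (indep _ lc≡0)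

  LinIndep₂ : ∀ {n} {u v : V n} → u ≢ 0V → (∀ μ → v ⊕ μ ⊙ u ≢ 0V) → LinIndep F (u ∷ v ∷ [])
  LinIndep₂ {u = u} {v} u≢0 v∉⟨u⟩ (c₁ ∷ c₂ ∷ []) lc≡0 with c₂ ≟F 0F
  ... | yes refl = cong (λ c → c ∷ 0F ∷ []) (a⊙v≡0⇒a≡0 u≢0 (trans (sym (lc₂-zeroʳ c₁ u v)) lc≡0))
  ... | no  c₂≢0 = ⊥-elim (v∉⟨u⟩ _ (a⊙v≡0⇒v≡0 c₂≢0 (trans (sym (lc₂-factor c₁ c₂≢0 u v)) lc≡0)))

  ¬LinIndep-multiple : ∀ {n} (u : V n) μ → ¬ LinIndep F (u ∷ μ ⊙ u ∷ [])
  ¬LinIndep-multiple u μ indep = 0≢1 (sym (∷-injectiveˡ (∷-injectiveʳ (indep ((-F μ) ∷ 1F ∷ []) dependence))))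
    where
    dependence : lc ((-F μ) ∷ 1F ∷ []) (u ∷ μ ⊙ u ∷ []) ≡ 0V
    dependence = trans (lc₂ _ _ u _) (trans (cong ((-F μ) ⊙ u ⊕_) (⊙-identityˡ _))
                                            (trans (⊕-comm _ _) (⊙-inverse μ u)))

  SubspaceWithin-map : ∀ {n k} {P Q : V n → Set} → (∀ {v} → v ≢ 0V → P v → Q v) →
                       SubspaceWithin F k P → SubspaceWithin F k Q
  SubspaceWithin-map P⇒Q (vs , indep , within) = vs , indep , λ c c≢0 → P⇒Q (lc-≢0 indep c≢0) (within c c≢0)

  lc-++-0V : ∀ {n j o} (c : Vec (Fin q) j) (us : Vec (V n) j) (ws : Vec (V n) o) →
             lc (c ++ 0V) (us ++ ws) ≡ lc c us
  lc-++-0V []       []       ws = lc-zeroˡ ws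
  lc-++-0V (c ∷ cs) (u ∷ us) ws = cong (c ⊙ u ⊕_) (lc-++-0V cs us ws)

  ++-0V-≡0 : ∀ {j o} (c : Vec (Fin q) j) → c ++ 0V {o} ≡ 0V → c ≡ 0V
  ++-0V-≡0 []       _  = refl
  ++-0V-≡0 (c ∷ cs) eq = cong₂ _∷_ (∷-injectiveˡ eq) (++-0V-≡0 cs (∷-injectiveʳ eq))

  SubspaceWithin-≤ : ∀ {n j k} {P : V n → Set} → j ≤ k → SubspaceWithin F k P → SubspaceWithin F j P
  SubspaceWithin-≤ {j = j} {P = P} j≤k W with o , refl ← m≤n⇒∃[o]m+o≡n j≤k = restrict W
    where
    restrict : ∀ {o} → SubspaceWithin F (j + o) P → SubspaceWithin F j P
    restrict (vs , indep , within) with us , ws , refl ← splitAt j vs =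
      us , (λ c lc≡0 → ++-0V-≡0 c (indep (c ++ 0V) (trans (lc-++-0V c us ws) lc≡0)))
         , (λ c c≢0 → subst P (lc-++-0V c us ws) (within (c ++ 0V) (c≢0 ∘ ++-0V-≡0 c)))

  -- Coordinates on F^(m+1) / ⟨b⟩: if b₀ ≠ 0, subtracting (x₀ / b₀) b clears the
  -- leading coordinate, which is dropped; if b₀ = 0 the leading coordinate is kept.
  mutual
    quotient : ∀ {m} → V (suc m) → V (suc m) → V m
    quotient {zero}  _        _        = []
    quotient {suc m} (b₀ ∷ b) (x₀ ∷ x) = quotient-step (b₀ ≟F 0F) b x₀ x

    quotient-step : ∀ {m b₀} → Dec (b₀ ≡ 0F) → V (suc m) → Fin q → V (suc m) → V (suc m)
    quotient-step           (yes _)   b x₀ x = x₀ ∷ quotient b x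
    quotient-step {b₀ = b₀} (no b₀≢0) b x₀ x = x ⊕ (x₀ *F (-F inv b₀ b₀≢0)) ⊙ b

  mutual
    section : ∀ {m} → V (suc m) → V m → V (suc m)
    section {zero}  _        _ = 0F ∷ []
    section {suc m} (b₀ ∷ b) u = section-step (b₀ ≟F 0F) b u

    section-step : ∀ {m b₀} → Dec (b₀ ≡ 0F) → V (suc m) → V (suc m) → V (suc (suc m))
    section-step (yes _) b (u₀ ∷ u) = u₀ ∷ section b u
    section-step (no _)  b u        = 0F ∷ u

  quotient-⊕ : ∀ {m} (b x y : V (suc m)) → quotient b (x ⊕ y) ≡ quotient b x ⊕ quotient b y
  quotient-⊕ {zero}  _        _        _        = refl
  quotient-⊕ {suc m} (b₀ ∷ b) (x₀ ∷ x) (y₀ ∷ y) with b₀ ≟F 0F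
  ... | yes _    = cong ((x₀ +F y₀) ∷_) (quotient-⊕ b x y)
  ... | no b₀≢0 = begin
    (x ⊕ y) ⊕ ((x₀ +F y₀) *F β) ⊙ b               ≡⟨ cong (λ c → (x ⊕ y) ⊕ c ⊙ b) (distribʳ β x₀ y₀) ⟩
    (x ⊕ y) ⊕ ((x₀ *F β) +F (y₀ *F β)) ⊙ b        ≡⟨ cong ((x ⊕ y) ⊕_) (⊙-distribʳ _ _ b) ⟩
    (x ⊕ y) ⊕ ((x₀ *F β) ⊙ b ⊕ (y₀ *F β) ⊙ b)     ≡⟨ ⊕-interchange x y _ _ ⟩
    (x ⊕ (x₀ *F β) ⊙ b) ⊕ (y ⊕ (y₀ *F β) ⊙ b)     ∎
    where
    β : Fin q
    β = -F inv b₀ b₀≢0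

  quotient-⊙ : ∀ {m} (b : V (suc m)) a x → quotient b (a ⊙ x) ≡ a ⊙ quotient b x
  quotient-⊙ {zero}  _        _ _        = refl
  quotient-⊙ {suc m} (b₀ ∷ b) a (x₀ ∷ x) with b₀ ≟F 0F
  ... | yes _    = cong ((a *F x₀) ∷_) (quotient-⊙ b a x)
  ... | no b₀≢0 = begin
    a ⊙ x ⊕ ((a *F x₀) *F β) ⊙ b   ≡⟨ cong (λ c → a ⊙ x ⊕ c ⊙ b) (*-assoc a x₀ β) ⟩
    a ⊙ x ⊕ (a *F (x₀ *F β)) ⊙ b   ≡⟨ cong (a ⊙ x ⊕_) (⊙-assoc a _ b) ⟩
    a ⊙ x ⊕ a ⊙ ((x₀ *F β) ⊙ b)    ≡⟨ ⊙-distribˡ a x _ ⟨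
    a ⊙ (x ⊕ (x₀ *F β) ⊙ b)        ∎
    where
    β : Fin q
    β = -F inv b₀ b₀≢0

  quotient-self : ∀ {m} (b : V (suc m)) → quotient b b ≡ 0V
  quotient-self {zero}  _        = refl
  quotient-self {suc m} (b₀ ∷ b) with b₀ ≟F 0F
  ... | yes b₀≡0 = cong₂ _∷_ b₀≡0 (quotient-self b)
  ... | no b₀≢0  = begin
    b ⊕ (b₀ *F (-F inv b₀ b₀≢0)) ⊙ b
      ≡⟨ cong₂ (λ u c → u ⊕ c ⊙ b) (⊙-identityˡ b) (-‿distribʳ-* b₀ _) ⟨
    1F ⊙ b ⊕ (-F (b₀ *F inv b₀ b₀≢0)) ⊙ b
      ≡⟨ cong (λ c → 1F ⊙ b ⊕ (-F c) ⊙ b) (inv-inverseʳ b₀ b₀≢0) ⟩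
    1F ⊙ b ⊕ (-F 1F) ⊙ b
      ≡⟨ ⊙-inverse 1F b ⟩
    0V
      ∎

  quotient-0V : ∀ {m} (b : V (suc m)) → quotient b 0V ≡ 0V
  quotient-0V b = begin
    quotient b 0V           ≡⟨ cong (quotient b) (⊙-zeroˡ 0V) ⟨
    quotient b (0F ⊙ 0V)    ≡⟨ quotient-⊙ b 0F 0V ⟩
    0F ⊙ quotient b 0V      ≡⟨ ⊙-zeroˡ _ ⟩
    0V                      ∎

  quotient-section : ∀ {m} (b : V (suc m)) u → quotient b (section b u) ≡ u
  quotient-section {zero}  _        [] = refl
  quotient-section {suc m} (b₀ ∷ b) u with b₀ ≟F 0F
  quotient-section {suc m} (b₀ ∷ b) (u₀ ∷ u) | yes b₀≡0 with b₀ ≟F 0F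
  ... | yes _    = cong (u₀ ∷_) (quotient-section b u)
  ... | no b₀≢0  = ⊥-elim (b₀≢0 b₀≡0)
  quotient-section {suc m} (b₀ ∷ b) u        | no b₀≢0 with b₀ ≟F 0F
  ... | yes b₀≡0 = ⊥-elim (b₀≢0 b₀≡0)
  ... | no _     = begin
    u ⊕ (0F *F _) ⊙ b   ≡⟨ cong (λ c → u ⊕ c ⊙ b) (zeroˡ _) ⟩
    u ⊕ 0F ⊙ b          ≡⟨ cong (u ⊕_) (⊙-zeroˡ b) ⟩
    u ⊕ 0V              ≡⟨ ⊕-identityʳ u ⟩
    u                   ∎

  quotient-kernel : ∀ {m} {b : V (suc m)} → b ≢ 0V → ∀ x → quotient b x ≡ 0V → ∃ λ μ → x ≡ μ ⊙ b
  quotient-kernel {zero} {b₀ ∷ []} b≢0 (x₀ ∷ []) _ with b₀ ≟F 0F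
  ... | yes b₀≡0 = ⊥-elim (b≢0 (cong (_∷ []) b₀≡0))
  ... | no b₀≢0  = x₀ *F inv b₀ b₀≢0 , cong (_∷ []) (sym (x*b⁻¹*b≡x x₀ b₀≢0))
  quotient-kernel {suc m} {b₀ ∷ b} b≢0 (x₀ ∷ x) qx≡0 with b₀ ≟F 0F
  ... | yes b₀≡0 with μ , x≡μb ← quotient-kernel (b≢0 ∘ cong₂ _∷_ b₀≡0) x (∷-injectiveʳ qx≡0) =
    μ , cong₂ _∷_ (trans (∷-injectiveˡ qx≡0) (sym (trans (cong (μ *F_) b₀≡0) (zeroʳ μ)))) x≡μb
  ... | no b₀≢0 = x₀ *F inv b₀ b₀≢0 , cong₂ _∷_ (sym (x*b⁻¹*b≡x x₀ b₀≢0)) (begin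
    x                                  ≡⟨ u⊕a⊙w≡0⇒u≡-a⊙w x b _ qx≡0 ⟩
    (-F (x₀ *F (-F inv b₀ b₀≢0))) ⊙ b  ≡⟨ cong (λ c → (-F c) ⊙ b) (-‿distribʳ-* x₀ _) ⟨
    (-F (-F (x₀ *F inv b₀ b₀≢0))) ⊙ b  ≡⟨ cong (_⊙ b) (-‿involutive _) ⟩
    (x₀ *F inv b₀ b₀≢0) ⊙ b            ∎)

  quotient-lc-section : ∀ {m k} (b : V (suc m)) c₀ (c : Vec (Fin q) k) us →
                        quotient b (lc (c₀ ∷ c) (b ∷ Vec.map (section b) us)) ≡ lc c us
  quotient-lc-section b c₀ c us = begin
    quotient b (c₀ ⊙ b ⊕ lc c (Vec.map (section b) us))               ≡⟨ quotient-⊕ b _ _ ⟩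
    quotient b (c₀ ⊙ b) ⊕ quotient b (lc c (Vec.map (section b) us))  ≡⟨ cong₂ _⊕_ c₀b↦0 (sections c us) ⟩
    0V ⊕ lc c us                                                      ≡⟨ ⊕-identityˡ _ ⟩
    lc c us                                                           ∎
    where
    c₀b↦0 : quotient b (c₀ ⊙ b) ≡ 0V
    c₀b↦0 = trans (quotient-⊙ b c₀ b) (trans (cong (c₀ ⊙_) (quotient-self b)) (⊙-zeroʳ c₀))

    sections : ∀ {k} (c : Vec (Fin q) k) us → quotient b (lc c (Vec.map (section b) us)) ≡ lc c us
    sections []       []       = quotient-0V b
    sections (c ∷ cs) (u ∷ us) = begin
      quotient b (c ⊙ section b u ⊕ lc cs (Vec.map (section b) us))
        ≡⟨ quotient-⊕ b _ _ ⟩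
      quotient b (c ⊙ section b u) ⊕ quotient b (lc cs _)
        ≡⟨ cong₂ _⊕_ (quotient-⊙ b c _) (sections cs us) ⟩
      c ⊙ quotient b (section b u) ⊕ lc cs us
        ≡⟨ cong (λ w → c ⊙ w ⊕ lc cs us) (quotient-section b u) ⟩
      c ⊙ u ⊕ lc cs us
        ∎

  quotient-identify : ∀ {m} {b y x : V (suc m)} {a} μ → a ≢ 0F → b ≡ a ⊙ (y ⊕ μ ⊙ x) →
                      quotient b y ≡ quotient b ((-F μ) ⊙ x)
  quotient-identify {b = b} {y} {x} {a} μ a≢0 b≡ = begin
    quotient b y             ≡⟨ u⊕a⊙w≡0⇒u≡-a⊙w _ _ μ in-kernel ⟩
    (-F μ) ⊙ quotient b x    ≡⟨ quotient-⊙ b (-F μ) x ⟨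
    quotient b ((-F μ) ⊙ x)  ∎
    where
    in-kernel : quotient b y ⊕ μ ⊙ quotient b x ≡ 0V
    in-kernel = a⊙v≡0⇒v≡0 a≢0 (begin
      a ⊙ (quotient b y ⊕ μ ⊙ quotient b x)    ≡⟨ cong (λ w → a ⊙ (quotient b y ⊕ w)) (quotient-⊙ b μ x) ⟨
      a ⊙ (quotient b y ⊕ quotient b (μ ⊙ x))  ≡⟨ cong (a ⊙_) (quotient-⊕ b y _) ⟨
      a ⊙ quotient b (y ⊕ μ ⊙ x)               ≡⟨ quotient-⊙ b a _ ⟨
      quotient b (a ⊙ (y ⊕ μ ⊙ x))             ≡⟨ cong (quotient b) b≡ ⟨
      quotient b b                             ≡⟨ quotient-self b ⟩
      0V                                       ∎)

  allVecs-suc : ∀ n → allVecs F (suc n) ≡ cartesianProductWith Vec._∷_ (allFin q) (allVecs F n)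
  allVecs-suc n = go (allFin q)
    where
    go : ∀ as → concatMap (λ a → map (a ∷_) (allVecs F n)) as ≡ cartesianProductWith Vec._∷_ as (allVecs F n)
    go []       = refl
    go (a ∷ as) = cong (map (a ∷_) (allVecs F n) List.++_) (go as)

  allVecs-complete : ∀ {n} (v : V n) → v ∈ allVecs F n
  allVecs-complete []               = here refl
  allVecs-complete {suc n} (a ∷ v) =
    subst (a ∷ v ∈_) (sym (allVecs-suc n)) (∈-cartesianProductWith⁺ Vec._∷_ (∈-allFin a) (allVecs-complete v))

  allVecs-unique : ∀ n → Unique (allVecs F n)
  allVecs-unique zero    = [] ∷ []
  allVecs-unique (suc n) =
    subst Unique (sym (allVecs-suc n)) (cartesianProductWith⁺ Vec._∷_ ∷-injective (allFin⁺ q) (allVecs-unique n))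

  length-allVecs : ∀ n → length (allVecs F n) ≡ q ^ n
  length-allVecs zero    = refl
  length-allVecs (suc n) = begin
    length (allVecs F (suc n))
      ≡⟨ cong length (allVecs-suc n) ⟩
    length (cartesianProductWith Vec._∷_ (allFin q) (allVecs F n))
      ≡⟨ length-product (allFin q) ⟩
    length (allFin q) * length (allVecs F n)
      ≡⟨ cong₂ _*_ (length-tabulate {n = q} id) (length-allVecs n) ⟩
    q * q ^ n
      ∎
    where
    length-product : ∀ as → length (cartesianProductWith Vec._∷_ as (allVecs F n)) ≡ length as * length (allVecs F n)
    length-product []       = refl
    length-product (a ∷ as) = trans (length-++ (map (a ∷_) (allVecs F n)))
                                    (cong₂ _+_ (length-map (a ∷_) (allVecs F n)) (length-product as))

  card≡count : ∀ {n} (A : V n → Bool) → card F A ≡ count A (allVecs F n)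
  card≡count {n} A = go (allVecs F n)
    where
    go : ∀ xs → countTrue F A xs ≡ count A xs
    go []       = refl
    go (x ∷ xs) = cong (_ +_) (go xs)

  count-nonzero : ∀ n → suc (count nonzero (allVecs F n)) ≡ q ^ n
  count-nonzero n = begin
    suc (count nonzero (allVecs F n))  ≡⟨ count-remove _≟V_ (λ _ → true) (allVecs-unique n) (allVecs-complete 0V) refl ⟨
    count (λ _ → true) (allVecs F n)   ≡⟨ count-true (allVecs F n) ⟩
    length (allVecs F n)               ≡⟨ length-allVecs n ⟩
    q ^ n                              ∎

  search-nonzero : ∀ {n} (P : V n → Bool) → (∃ λ v → v ≢ 0V × P v ≡ true) ⊎ (∀ v → v ≢ 0V → P v ≡ false)
  search-nonzero P with search (λ v → nonzero v ∧ P v) (allVecs F _)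
  ... | inj₁ (v , found) = inj₁ (v , nonzero-≢0 (∧-conicalˡ _ _ found) , ∧-conicalʳ _ _ found)
  ... | inj₂ absent      = inj₂ λ v v≢0 → trans (sym (∧-identityˡ (P v)))
                                          (trans (cong (_∧ P v) (sym (≢0-nonzero v≢0))) (absent v (allVecs-complete v)))

module Ramsey {q : ℕ} (F : FiniteField q) where

  open FiniteField F
  open VectorSpace F

  instance
    q-nonZero : NonZero q
    q-nonZero = nonZeroIndex 0F

  IsCone : ∀ {n} → (V n → Bool) → Set
  IsCone R = ∀ v a → v ≢ 0V → a ≢ 0F → R (a ⊙ v) ≡ R v

  true⇒≢0 : ∀ {n} (R : V n → Bool) → R 0V ≡ false → ∀ {v} → R v ≡ true → v ≢ 0V
  true⇒≢0 R R0 Rv refl with trans (sym Rv) R0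
  ... | ()

  _/_ : ∀ {m} → (V (suc m) → Bool) → V (suc m) → V m → Bool
  R / b = image _≟V_ (quotient b) R (allVecs F _)

  /-intro : ∀ {m} (R : V (suc m) → Bool) b {x} → R x ≡ true → (R / b) (quotient b x) ≡ true
  /-intro R b Rx = image-intro _≟V_ (quotient b) R (allVecs-complete _) Rx

  count-/ : ∀ {m} (R : V (suc m) → Bool) b → count (R / b) (allVecs F m) ≤ count R (allVecs F (suc m))
  count-/ R b = count-image _≟V_ (quotient b) R (allVecs F _) (allVecs-unique _)

  module _ {m} {R : V (suc m) → Bool} (R0 : R 0V ≡ false) (cone : IsCone R) {b : V (suc m)} where

    /-scale : ∀ c {u} → c ≢ 0F → (R / b) u ≡ true → (R / b) (c ⊙ u) ≡ true
    /-scale c c≢0 R/bu with x , Rx , refl ← image-elim _≟V_ (quotient b) R (allVecs F _) R/bu =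
      subst (λ w → (R / b) w ≡ true) (quotient-⊙ b c x) (/-intro R b (trans (cone x c (true⇒≢0 R R0 Rx) c≢0) Rx))

    /-cone : IsCone (R / b)
    /-cone u a u≢0 a≢0 with (R / b) u in R/bu | (R / b) (a ⊙ u) in R/bau
    ... | true  | true  = refl
    ... | false | false = refl
    ... | true  | false = trans (sym R/bau) (/-scale a a≢0 R/bu)
    ... | false | true  = trans (sym (subst (λ w → (R / b) w ≡ true) (⊙-inv-cancel a a≢0 u)
                                             (/-scale (inv a a≢0) (inv-≢0 a a≢0) R/bau))) R/bu

    /-0V : b ≢ 0V → R b ≡ false → (R / b) 0V ≡ false
    /-0V b≢0 Rb = ¬-not absurd
      where
      absurd : (R / b) 0V ≢ true
      absurd R/b0 with image-elim _≟V_ (quotient b) R (allVecs F _) R/b0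
      ... | x , Rx , qx≡0 with quotient-kernel b≢0 x qx≡0
      ...   | μ , refl with μ ≟F 0F
      ...     | yes refl = true⇒≢0 R R0 Rx (⊙-zeroˡ b)
      ...     | no  μ≢0  with trans (sym Rx) (trans (cone b μ b≢0 μ≢0) Rb)
      ...       | ()

  count-/-collapse : ∀ {m} (R : V (suc m) → Bool) b {x y} → R x ≡ true → R y ≡ true → x ≢ y →
                     quotient b x ≡ quotient b y → suc (count (R / b) (allVecs F m)) ≤ count R (allVecs F (suc m))
  count-/-collapse {m} R b {x} {y} Rx Ry x≢y qx≡qy = begin
    suc (count (R / b) (allVecs F m))    ≤⟨ s≤s (count-mono image⊆ (allVecs F m)) ⟩
    suc (count R-y/b (allVecs F m))      ≤⟨ s≤s (count-image _≟V_ (quotient b) R-y (allVecs F (suc m)) (allVecs-unique m)) ⟩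
    suc (count R-y (allVecs F (suc m)))  ≡⟨ count-remove _≟V_ R (allVecs-unique (suc m)) (allVecs-complete y) Ry ⟨
    count R (allVecs F (suc m))          ∎
    where
    open ≤-Reasoning

    R-y : V (suc m) → Bool
    R-y v = R v ∧ not ⌊ v ≟V y ⌋

    R-y/b : V m → Bool
    R-y/b = image _≟V_ (quotient b) R-y (allVecs F (suc m))

    R-y-intro : ∀ {v} → R v ≡ true → v ≢ y → R-y v ≡ true
    R-y-intro {v} Rv v≢y with v ≟V y
    ... | yes v≡y = ⊥-elim (v≢y v≡y)
    ... | no  _   = trans (∧-identityʳ _) Rv

    image⊆ : ∀ u → (R / b) u ≡ true → R-y/b u ≡ true
    image⊆ u R/bu with z , Rz , refl ← image-elim _≟V_ (quotient b) R (allVecs F _) R/bu with z ≟V y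
    ... | no  z≢y = image-intro _≟V_ (quotient b) R-y (allVecs-complete z) (R-y-intro Rz z≢y)
    ... | yes refl = subst (λ w → R-y/b w ≡ true) qx≡qy
                           (image-intro _≟V_ (quotient b) R-y (allVecs-complete x) (R-y-intro Rx x≢y))

  lift-avoiding : ∀ {m k} {R : V (suc m) → Bool} → IsCone R → ∀ {b} → b ≢ 0V → R b ≡ false →
                  SubspaceWithin F k (λ u → (R / b) u ≡ false) → SubspaceWithin F (suc k) (λ v → R v ≡ false)
  lift-avoiding {m} {k} {R} cone {b} b≢0 Rb (us , indep , avoid) = b ∷ lifts , indep-lifts , avoid-lifts
    where
    lifts : Vec (V (suc m)) k
    lifts = Vec.map (section b) us

    indep-lifts : LinIndep F (b ∷ lifts)
    indep-lifts (c₀ ∷ c) lc≡0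
      with refl ← indep c (trans (sym (quotient-lc-section b c₀ c us))
                                 (trans (cong (quotient b) lc≡0) (quotient-0V b))) =
      cong (_∷ 0V) (a⊙v≡0⇒a≡0 b≢0 (trans (sym (⊕-identityʳ _))
                                         (trans (cong (c₀ ⊙ b ⊕_) (sym (lc-zeroˡ lifts))) lc≡0)))

    avoid-lifts : ∀ c → c ≢ 0V → R (lc c (b ∷ lifts)) ≡ false
    avoid-lifts (c₀ ∷ c) c≢0 with c ≟V 0V
    ... | no c≢0′ = ¬-not λ Rv →
      not-¬ (subst (λ u → (R / b) u ≡ true) (quotient-lc-section b c₀ c us) (/-intro R b Rv)) (avoid c c≢0′)
    ... | yes refl = trans (cong R (trans (cong (c₀ ⊙ b ⊕_) (lc-zeroˡ lifts)) (⊕-identityʳ _)))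
                           (trans (cone b c₀ b≢0 c₀≢0) Rb)
      where
      c₀≢0 : c₀ ≢ 0F
      c₀≢0 refl = c≢0 refl

  avoiding-subspace : ∀ k s (R : V (k + s) → Bool) → R 0V ≡ false → IsCone R →
                      2 + count R (allVecs F (k + s)) ≤ q ^ suc s → SubspaceWithin F k (λ v → R v ≡ false)
  avoiding-subspace zero    s R R0 cone few = [] , (λ { [] _ → refl }) , (λ { [] []≢0 → ⊥-elim ([]≢0 refl) })
  avoiding-subspace (suc k) s R R0 cone few with count-witness R nonzero (allVecs F (suc k + s)) fewer-red
    where
    fewer-red : count R (allVecs F (suc k + s)) < count nonzero (allVecs F (suc k + s))
    fewer-red = ≤-pred (≤-trans few (≤-trans (^-monoʳ-≤ q (s≤s (m≤n+m s k)))
                                             (≤-reflexive (sym (count-nonzero (suc k + s))))))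
  ... | b , nonzero-b , Rb = lift-avoiding cone b≢0 Rb
        (avoiding-subspace k s (R / b) (/-0V R0 cone b≢0 Rb) (/-cone R0 cone) (≤-trans (+-monoʳ-≤ 2 (count-/ R b)) few))
    where
    b≢0 : b ≢ 0V
    b≢0 = nonzero-≢0 nonzero-b

  plane-through-line : ∀ {n} {R : V n → Bool} → R 0V ≡ false → IsCone R → ∀ {d x} → R d ≡ true →
             (∀ μ → R (x ⊕ μ ⊙ d) ≡ true) → SubspaceWithin F 2 (λ v → R v ≡ true)
  plane-through-line {R = R} R0 cone {d} {x} Rd line =
    d ∷ x ∷ [] , LinIndep₂ d≢0 (λ μ → true⇒≢0 R R0 (line μ)) , red
    where
    d≢0 : d ≢ 0V
    d≢0 = true⇒≢0 R R0 Rd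

    red : ∀ c → c ≢ 0V → R (lc c (d ∷ x ∷ [])) ≡ true
    red (c₁ ∷ c₂ ∷ []) c≢0 with c₂ ≟F 0F
    ... | no c₂≢0 = trans (cong R (lc₂-factor c₁ c₂≢0 d x))
                          (trans (cone _ c₂ (true⇒≢0 R R0 (line _)) c₂≢0) (line _))
    ... | yes refl with c₁ ≟F 0F
    ...   | yes refl = ⊥-elim (c≢0 refl)
    ...   | no c₁≢0  = trans (cong R (lc₂-zeroʳ c₁ d x)) (trans (cone d c₁ d≢0 c₁≢0) Rd)

  plane-or-avoiding-from-directions : ∀ {n t} {R : V n → Bool} → R 0V ≡ false → IsCone R → ωDir≥ F R t →
      SubspaceWithin F 2 (λ v → R v ≡ true) ⊎ SubspaceWithin F t (λ v → R v ≡ false)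
  plane-or-avoiding-from-directions {R = R} R0 cone (k , t≤k , vs , indep , directions)
    with search-nonzero (λ c → R (lc c vs))
  ... | inj₁ (c , c≢0 , Rd) = inj₁ (plane-through-line R0 cone Rd (proj₂ (directions c c≢0)))
  ... | inj₂ avoid          = inj₂ (SubspaceWithin-≤ {P = λ v → R v ≡ false} t≤k (vs , indep , avoid))

  2≤q : 2 ≤ q
  2≤q = distinct 0F 1F 0≢1
    where
    distinct : ∀ {n} (a b : Fin n) → a ≢ b → 2 ≤ n
    distinct {suc zero}    Fin.zero Fin.zero a≢b = ⊥-elim (a≢b refl)
    distinct {suc (suc n)} _        _        _   = s≤s (s≤s z≤n)

  2+q≤q^[2+s] : ∀ s → 2 + q ≤ q ^ suc (suc s)
  2+q≤q^[2+s] s = begin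
    2 + q            ≤⟨ +-monoˡ-≤ q 2≤q ⟩
    q + q            ≡⟨ cong (q +_) (ℕ.+-identityʳ q) ⟨
    2 * q            ≤⟨ *-monoˡ-≤ q 2≤q ⟩
    q * q            ≡⟨ cong (q *_) (ℕ.*-identityʳ q) ⟨
    q ^ 2            ≤⟨ ^-monoʳ-≤ q (s≤s (s≤s (z≤n {s}))) ⟩
    q ^ suc (suc s)  ∎
    where open ≤-Reasoning

  module OnThreshold (k s : ℕ) {R : V (suc k + suc s) → Bool} (R0 : R 0V ≡ false) (cone : IsCone R)
                     (|R|≡ : suc (count R (allVecs F (suc k + suc s))) ≡ q ^ suc (suc s)) where

    N : ℕ
    N = suc k + suc s

    q<|R| : q < count R (allVecs F N)
    q<|R| = ≤-pred (≤-trans (2+q≤q^[2+s] s) (≤-reflexive (sym |R|≡)))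

    p-witness : ∃ λ p → R p ≡ true
    p-witness = count-pos R (allVecs F N) (≤-<-trans z≤n q<|R|)

    p : V N
    p = proj₁ p-witness

    Rp : R p ≡ true
    Rp = proj₂ p-witness

    onLine : V N → Bool
    onLine = image _≟V_ (_⊙ p) (λ _ → true) (allFin q)

    count-onLine : count onLine (allVecs F N) ≤ q
    count-onLine = ≤-trans (count-image _≟V_ (_⊙ p) (λ _ → true) (allFin q) (allVecs-unique N))
                           (≤-trans (count-≤-length _ (allFin q)) (≤-reflexive (length-tabulate {n = q} id)))

    p′-witness : ∃ λ p′ → R p′ ≡ true × onLine p′ ≡ false
    p′-witness = count-witness onLine R (allVecs F N) (≤-<-trans count-onLine q<|R|)

    p′ : V N
    p′ = proj₁ p′-witness

    Rp′ : R p′ ≡ true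
    Rp′ = proj₁ (proj₂ p′-witness)

    off-line : ∀ μ → μ ⊙ p ≢ p′
    off-line μ μp≡p′ =
      not-¬ (subst (λ v → onLine v ≡ true) μp≡p′ (image-intro _≟V_ (_⊙ p) (λ _ → true) (∈-allFin μ) refl))
            (proj₂ (proj₂ p′-witness))

    plane : Vec (V N) 2
    plane = p ∷ p′ ∷ []

    indep : LinIndep F plane
    indep = LinIndep₂ (true⇒≢0 R R0 Rp) (λ μ e → off-line (-F μ) (sym (u⊕a⊙w≡0⇒u≡-a⊙w p′ p μ e)))

    collapse : ∀ c → c ≢ 0V → R (lc c plane) ≡ false → SubspaceWithin F (suc k) (λ v → R v ≡ false)
    collapse (c₁ ∷ c₂ ∷ []) c≢0 Rw =
      lift-avoiding cone w≢0 Rw (avoiding-subspace k (suc s) (R / w) (/-0V R0 cone w≢0 Rw) (/-cone R0 cone) fewer)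
      where
      w : V N
      w = lc (c₁ ∷ c₂ ∷ []) plane

      w≢0 : w ≢ 0V
      w≢0 = lc-≢0 indep c≢0

      c₂≢0 : c₂ ≢ 0F
      c₂≢0 refl with c₁ ≟F 0F
      ... | yes refl = c≢0 refl
      ... | no c₁≢0  =
        not-¬ (trans (cong R (lc₂-zeroʳ c₁ p p′)) (trans (cone p c₁ (true⇒≢0 R R0 Rp) c₁≢0) Rp)) Rw

      c₁≢0 : c₁ ≢ 0F
      c₁≢0 refl =
        not-¬ (trans (cong R (lc₂-zeroˡ c₂ p p′)) (trans (cone p′ c₂ (true⇒≢0 R R0 Rp′) c₂≢0) Rp′)) Rw

      μ : Fin q
      μ = inv c₂ c₂≢0 *F c₁

      -μp-red : R ((-F μ) ⊙ p) ≡ true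
      -μp-red = trans (cone p (-F μ) (true⇒≢0 R R0 Rp) (-‿≢0 (*-≢0 (inv-≢0 c₂ c₂≢0) c₁≢0))) Rp

      fewer : 2 + count (R / w) (allVecs F (k + suc s)) ≤ q ^ suc (suc s)
      fewer = ≤-trans (s≤s (count-/-collapse R w -μp-red Rp′ (off-line (-F μ))
                                (sym (quotient-identify μ c₂≢0 (lc₂-factor c₁ c₂≢0 p p′)))))
                      (≤-reflexive |R|≡)

    dichotomy : SubspaceWithin F 2 (λ v → R v ≡ true) ⊎ SubspaceWithin F (suc k) (λ v → R v ≡ false)
    dichotomy with search-nonzero (λ c → not (R (lc c plane)))
    ... | inj₁ (c , c≢0 , blue) = inj₂ (collapse c c≢0 (not-injective blue))
    ... | inj₂ red              = inj₁ (plane , indep , λ c c≢0 → not-injective (red c c≢0))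

  plane-or-avoiding : ∀ k s (R : V (suc k + suc s) → Bool) → R 0V ≡ false → IsCone R →
      count R (allVecs F (suc k + suc s)) < q ^ suc (suc s) →
      SubspaceWithin F 2 (λ v → R v ≡ true) ⊎ SubspaceWithin F (suc k) (λ v → R v ≡ false)
  plane-or-avoiding k s R R0 cone few with m≤n⇒m<n∨m≡n few
  ... | inj₁ fewer = inj₂ (avoiding-subspace (suc k) (suc s) R R0 cone fewer)
  ... | inj₂ |R|≡  = OnThreshold.dichotomy k s R0 cone |R|≡

  axis : ∀ {m} → V (suc m) → Bool
  axis v = ⌊ tail v ≟V 0V ⌋

  count-axis : ∀ m → count axis (allVecs F (suc m)) ≡ q
  count-axis m = trans (cong (count axis) (allVecs-suc m)) (trans (go (allFin q)) (length-tabulate {n = q} id))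
    where
    count-≟0V : count (λ v → ⌊ v ≟V 0V ⌋) (allVecs F m) ≡ 1
    count-≟0V = trans (count-remove _≟V_ _ (allVecs-unique m) (allVecs-complete 0V) (≟V-refl 0V))
                      (cong suc (trans (count-cong (λ v → ∧-inverseʳ ⌊ v ≟V 0V ⌋) (allVecs F m))
                                       (count-false (allVecs F m))))

    go : ∀ as → count axis (cartesianProductWith Vec._∷_ as (allVecs F m)) ≡ length as
    go []       = refl
    go (a ∷ as) = trans (count-++ axis (map (a ∷_) (allVecs F m)) _)
                        (cong₂ _+_ (trans (count-map axis (a ∷_) (allVecs F m)) count-≟0V) (go as))

  axis-direction : ∀ {m} {d : V (suc m)} → InDirSet F axis d → tail d ≡ 0V
  axis-direction {d = d₀ ∷ d} (x₀ ∷ x , line) = begin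
    d            ≡⟨ ⊕-identityˡ d ⟨
    0V ⊕ d       ≡⟨ cong₂ _⊕_ x≡0 (⊙-identityˡ d) ⟨
    x ⊕ 1F ⊙ d   ≡⟨ ≟V-≡true (line 1F) ⟩
    0V           ∎
    where
    open ≡-Reasoning
    x≡0 : x ≡ 0V
    x≡0 = trans (sym (trans (cong (x ⊕_) (⊙-zeroˡ d)) (⊕-identityʳ x))) (≟V-≡true (line 0F))

  axis-multiple : ∀ {m} {u v : V (suc m)} → u ≢ 0V → tail u ≡ 0V → tail v ≡ 0V → ∃ λ μ → v ≡ μ ⊙ u
  axis-multiple {u = u₀ ∷ _} {v₀ ∷ _} u≢0 refl refl with u₀ ≟F 0F
  ... | yes refl = ⊥-elim (u≢0 refl)
  ... | no u₀≢0  = v₀ *F inv u₀ u₀≢0 , cong₂ _∷_ (sym (x*b⁻¹*b≡x v₀ u₀≢0)) (sym (⊙-zeroʳ _))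

  ¬plane-in-axis : ∀ {m} → ¬ SubspaceWithin F 2 (λ (v : V (suc m)) → tail v ≡ 0V)
  ¬plane-in-axis (u ∷ v ∷ [] , indep , onAxis) =
    ¬LinIndep-multiple u (proj₁ v∈⟨u⟩) (subst (λ w → LinIndep F (u ∷ w ∷ [])) (proj₂ v∈⟨u⟩) indep)
    where
    e₁ e₂ : Vec (Fin q) 2
    e₁ = 1F ∷ 0F ∷ []
    e₂ = 0F ∷ 1F ∷ []

    e₁≢0 : e₁ ≢ 0V
    e₁≢0 e = 0≢1 (sym (∷-injectiveˡ e))

    e₂≢0 : e₂ ≢ 0V
    e₂≢0 e = 0≢1 (sym (∷-injectiveˡ (∷-injectiveʳ e)))

    lc-e₁ : lc e₁ (u ∷ v ∷ []) ≡ u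
    lc-e₁ = trans (lc₂-zeroʳ 1F u v) (⊙-identityˡ u)

    lc-e₂ : lc e₂ (u ∷ v ∷ []) ≡ v
    lc-e₂ = trans (lc₂-zeroˡ 1F u v) (⊙-identityˡ v)

    u≢0 : u ≢ 0V
    u≢0 u≡0 = lc-≢0 indep e₁≢0 (trans lc-e₁ u≡0)

    v∈⟨u⟩ : ∃ λ μ → v ≡ μ ⊙ u
    v∈⟨u⟩ = axis-multiple u≢0 (subst (λ w → tail w ≡ 0V) lc-e₁ (onAxis e₁ e₁≢0))
                              (subst (λ w → tail w ≡ 0V) lc-e₂ (onAxis e₂ e₂≢0))

  card-axis-large : ∀ {m t} → suc m ≤ t → q ^ (suc m + 1) ≤ card F axis * q ^ t
  card-axis-large {m} {t} m<t = subst (λ c → q ^ (suc m + 1) ≤ c * q ^ t) (sym (trans (card≡count axis) (count-axis m)))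
                                      (*-monoʳ-≤ q (^-monoʳ-≤ q (subst (_≤ t) (ℕ.+-comm 1 m) m<t)))

  n≤t⇒¬MProp : ∀ {t n} → 2 ≤ t → n ≤ t → ¬ MProp F t n
  n≤t⇒¬MProp {t} {zero} 2≤t _ mprop
    with k , t≤k , W ← mprop (λ _ → true) (≤-trans (^-monoʳ-≤ q (≤-trans (s≤s z≤n) 2≤t)) (m≤m+n _ 0))
    with [] ∷ [] , indep , _ ← SubspaceWithin-≤ (≤-trans (s≤s z≤n) (≤-trans 2≤t t≤k)) W =
    0≢1 (sym (∷-injectiveˡ (indep (1F ∷ []) refl)))
  n≤t⇒¬MProp {t} {suc m} 2≤t m<t mprop with k , t≤k , W ← mprop axis (card-axis-large m<t) =
    ¬plane-in-axis (SubspaceWithin-≤ {P = λ v → tail v ≡ 0V} (≤-trans 2≤t t≤k)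
                                     (SubspaceWithin-map (λ {v} _ → axis-direction {d = v}) W))

  MProp⇒RamseyProp : ∀ k s → MProp F (suc k) (suc k + suc s) → RamseyProp F (suc k) (suc k + suc s)
  MProp⇒RamseyProp k s mprop (χ , χ-cone) =
    Sum.map (SubspaceWithin-map λ {v} _ → ∧-conicalˡ (χ v) (nonzero v)) (SubspaceWithin-map red-false⇒χ-false) dichotomy
    where
    R : V (suc k + suc s) → Bool
    R v = χ v ∧ nonzero v

    R0 : R 0V ≡ false
    R0 = trans (cong (χ 0V ∧_) nonzero-0V) (∧-zeroʳ _)

    R-cone : IsCone R
    R-cone v a v≢0 a≢0 =
      cong₂ _∧_ (χ-cone v a v≢0 a≢0) (trans (≢0-nonzero (⊙-≢0 a≢0 v≢0)) (sym (≢0-nonzero v≢0)))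

    red-false⇒χ-false : ∀ {v} → v ≢ 0V → R v ≡ false → χ v ≡ false
    red-false⇒χ-false {v} v≢0 Rv = trans (sym (trans (cong (χ v ∧_) (≢0-nonzero v≢0)) (∧-identityʳ _))) Rv

    threshold : q ^ suc (suc s) ≤ count R (allVecs F (suc k + suc s)) → q ^ (suc k + suc s + 1) ≤ card F R * q ^ suc k
    threshold many = begin
      q ^ (suc k + suc s + 1)            ≡⟨ cong (q ^_) (trans (ℕ.+-comm (suc k + suc s) 1)
                                                               (cong suc (ℕ.+-comm (suc k) (suc s)))) ⟩
      q ^ (suc (suc s) + suc k)          ≡⟨ ^-distribˡ-+-* q (suc (suc s)) (suc k) ⟩
      q ^ suc (suc s) * q ^ suc k        ≤⟨ *-monoˡ-≤ (q ^ suc k) many ⟩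
      count R (allVecs F _) * q ^ suc k  ≡⟨ cong (_* q ^ suc k) (card≡count R) ⟨
      card F R * q ^ suc k               ∎
      where open ≤-Reasoning

    dichotomy : SubspaceWithin F 2 (λ v → R v ≡ true) ⊎ SubspaceWithin F (suc k) (λ v → R v ≡ false)
    dichotomy with q ^ suc (suc s) ≤? count R (allVecs F _)
    ... | yes many = plane-or-avoiding-from-directions R0 R-cone (mprop R (threshold many))
    ... | no  few  = plane-or-avoiding k s R R0 R-cone (≰⇒> few)

lemma6p2 : ∀ (q : ℕ) (F : FiniteField q) (t : ℕ) → 2 ≤ t →
    ∀ (n : ℕ) → IsMq F t n → RamseyProp F t n
lemma6p2 q F (suc k) 2≤t n (mprop , _) with suc k <? n
... | no  t≮n = ⊥-elim (Ramsey.n≤t⇒¬MProp F 2≤t (≮⇒≥ t≮n) mprop)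
... | yes t<n with m≤n⇒∃[o]m+o≡n (<⇒≤ t<n)
...   | zero  , refl = ⊥-elim (<-irrefl (sym (ℕ.+-identityʳ (suc k))) t<n)
...   | suc s , refl = Ramsey.MProp⇒RamseyProp F k s mprop
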